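{- Let $H$ be a finite graph and $L$ a list assignment of $H$ such that $|L(v)|\ge \deg(v)+1$ for every vertex $v\in V(H)$. If $\mathbf{c}$ is a uniformly random proper $L$-colouring of $H$, then for every colour $x\in \bigcup_{v\in V(H)} L(v)$, the probability that $\mathbf{c}(v)\neq x$ for all $v\in V(H)$ is at least \[ \prod_{v\in V(H)} \left(1- \frac{1}{|L(v)|-\deg(v)}\right).\]
   Context: A list assignment of $H$ is a map $L\colon V(H)\to 2^{\mathbb{N}}$ (finite lists); a proper $L$-colouring is a map $c\colon V(H)\to\mathbb{N}$ with $c(v)\in L(v)$ for every vertex $v$ and $c(u)\neq c(v)$ for every edge $uv$. -}

module Defs where

open import Data.Bool using (Bool; true; false; not; _∧_; _∨_; if_then_else_)
open import Data.Nat using (ℕ; zero; suc; _∸_; _≡ᵇ_)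
open import Data.Fin using (Fin; zero; suc)
open import Data.List using (List; []; _∷_; map; concatMap; length; filterᵇ; foldr; allFin)
open import Data.Integer using (+_)
open import Data.Rational using (ℚ; _/_; 0ℚ; 1ℚ; _*_; _-_)
open import Relation.Binary.PropositionalEquality using (_≡_)

record Graph (n : ℕ) : Set where
  field
    adj       : Fin n → Fin n → Bool
    adj-sym   : ∀ u v → adj u v ≡ adj v u
    adj-irrefl : ∀ v → adj v v ≡ false
open Graph public

allᵇ : ∀ {A : Set} → (A → Bool) → List A → Bool
allᵇ p = foldr (λ a b → p a ∧ b) true

countᵇ : ∀ {A : Set} → (A → Bool) → List A → ℕ
countᵇ p xs = length (filterᵇ p xs)

deg : ∀ {n} → Graph n → Fin n → ℕ
deg H v = countᵇ (adj H v) (allFin _)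

-- A list assignment: each vertex gets a finite list of colours in ℕ
-- (duplicate-freeness is required separately in the statement).
ListAssignment : ℕ → Set
ListAssignment n = Fin n → List ℕ

-- All maps c : Fin n → ℕ with c v ∈ L v (one entry per choice of colours).
consF : ∀ {n} → ℕ → (Fin n → ℕ) → Fin (suc n) → ℕ
consF a f zero    = a
consF a f (suc i) = f i

choices : ∀ n → ListAssignment n → List (Fin n → ℕ)
choices zero    L = (λ ()) ∷ []
choices (suc n) L =
  concatMap (λ a → map (consF a) (choices n (λ i → L (suc i)))) (L zero)

isProper : ∀ {n} → Graph n → (Fin n → ℕ) → Bool
isProper {n} H c =
  allᵇ (λ u → allᵇ (λ v → not (adj H u v) ∨ not (c u ≡ᵇ c v)) (allFin n)) (allFin n)

avoids : ∀ {n} → ℕ → (Fin n → ℕ) → Bool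
avoids {n} x c = allᵇ (λ v → not (c v ≡ᵇ x)) (allFin n)

properColourings : ∀ {n} → Graph n → ListAssignment n → List (Fin n → ℕ)
properColourings {n} H L = filterᵇ (isProper H) (choices n L)

-- p / q as a rational number (with the convention p / 0 = 0; only used with q > 0)
frac : ℕ → ℕ → ℚ
frac p zero    = 0ℚ
frac p (suc q) = (+ p) / suc q

probAvoid : ∀ {n} → Graph n → ListAssignment n → ℕ → ℚ
probAvoid H L x =
  frac (countᵇ (avoids x) (properColourings H L)) (length (properColourings H L))

bound : ∀ {n} → Graph n → ListAssignment n → ℚ
bound {n} H L =
  foldr (λ v r → (1ℚ - frac 1 (length (L v) ∸ deg H v)) * r) 1ℚ (allFin n)

module Submission where

-- Let A(W) be the number of proper L-colourings that avoid x on the vertex set W, and add the vertices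
-- one at a time. Fix W and v ∉ W, and take a colouring counted by A(W) with c(v) = x. Recolouring v by
-- any colour of L(v) unused on its neighbourhood, of which there are at least k = |L(v)| - deg(v),
-- keeps it proper and avoiding x on W, and for a fixed new colour a the recoloured colourings are
-- distinct (the old one is recovered by recolouring v back to x) and have colour a at v. Summing over a,
-- k times the number of colourings with c(v) = x is at most A(W), so A(W + v) ≥ (1 - 1/k) A(W).
-- Multiplying over all vertices gives A(V) ≥ ∏ (1 - 1/k) · A(∅), and A(∅) > 0 because colouring
-- greedily produces a proper colouring.

open import Defs
open import Data.Bool using (Bool; true; false; T; T?; not; _∧_; _∨_)
open import Data.Bool.Properties using (T-∧; T-∨; ∧-zeroʳ; ∧-comm; ∧-assoc)
open import Data.Bool.ListAction using (any)
open import Data.Empty using (⊥-elim)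
open import Data.Fin using (Fin; zero; suc; _≟_)
import Data.Integer as ℤ
import Data.Integer.Properties as ℤₚ
open import Data.List using (List; []; _∷_; map; concatMap; length; filterᵇ; foldr; allFin; tabulate)
open import Data.List.Properties using (map-cong; map-∘; map-++; length-map; map-tabulate; foldr-cong; foldr-map)
open import Data.List.Membership.Propositional using (_∈_)
open import Data.List.Membership.Propositional.Properties using (∈-allFin; ∈-map⁺; ∈-filter⁺; ∈-concatMap⁺)
import Data.List.Relation.Unary.All as All
open import Data.List.Relation.Unary.All.Properties using (All¬⇒¬Any)
open import Data.List.Relation.Unary.AllPairs using ([]; _∷_)
open import Data.List.Relation.Unary.Any as Any using (here; there)
open import Data.List.Relation.Unary.Unique.Propositional using (Unique)
open import Data.List.Relation.Unary.Unique.Propositional.Properties using (allFin⁺)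
open import Data.Nat using (ℕ; zero; suc; pred; _+_; _*_; _∸_; _≡ᵇ_; _≤_; _<_; z≤n; s≤s; >-nonZero)
open import Data.Nat.ListAction using (sum; product)
open import Data.Nat.ListAction.Properties using (sum-++)
open import Data.Nat.Properties
  using (≤-refl; ≤-reflexive; ≤-trans; ≤-<-trans; +-comm; *-comm; *-assoc; +-identityʳ; *-identityʳ; *-zeroʳ;
         *-distribˡ-+; +-mono-≤; +-monoʳ-≤; *-monoʳ-≤; *-monoˡ-≤; +-cancelʳ-≤; m≤n+m; ∸-monoʳ-≤; m+n∸n≡m;
         m<n⇒0<n∸m; suc-pred; ≡ᵇ⇒≡; ≡⇒≡ᵇ; module ≤-Reasoning)
open import Data.Nat.Tactic.RingSolver using (solve-∀)
open import Data.Product using (∃; _×_; _,_; proj₁; proj₂)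
import Data.Rational
open import Data.Rational as ℚ using (1ℚ; toℚᵘ)
open import Data.Rational.Properties using (toℚᵘ-fromℚᵘ; toℚᵘ-homo-+; toℚᵘ-homo‿-; toℚᵘ-homo-*; toℚᵘ-cancel-≤)
import Data.Rational.Unnormalised as ℚᵘ
open import Data.Rational.Unnormalised using (mkℚᵘ; *≡*; *≤*) renaming (_≃_ to _≃ᵘ_; _≤_ to _≤ᵘ_)
import Data.Rational.Unnormalised.Properties as ℚᵘₚ
open import Data.Sum using (inj₁; inj₂)
open import Data.Vec.Functional using (updateAt)
open import Data.Vec.Functional.Properties using (updateAt-updates; updateAt-minimal)
open import Function using (_∘_; id; const; Equivalence)
open import Relation.Binary.PropositionalEquality
open import Relation.Nullary using (¬_; yes; no)

private variable
  A B : Set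
  n : ℕ

-- Indicator sums and counting

𝟙 : Bool → ℕ
𝟙 true  = 1
𝟙 false = 0

∑ : List A → (A → ℕ) → ℕ
∑ xs f = sum (map f xs)

∑-cong : ∀ (xs : List A) {f g : A → ℕ} → (∀ a → f a ≡ g a) → ∑ xs f ≡ ∑ xs g
∑-cong xs f≗g = cong sum (map-cong f≗g xs)

∑-mono : ∀ (xs : List A) {f g : A → ℕ} → (∀ {a} → a ∈ xs → f a ≤ g a) → ∑ xs f ≤ ∑ xs g
∑-mono []       f≤g = z≤n
∑-mono (x ∷ xs) f≤g = +-mono-≤ (f≤g (here refl)) (∑-mono xs (f≤g ∘ there))

∑-zero : ∀ (xs : List A) → ∑ xs (λ _ → 0) ≡ 0
∑-zero []       = refl
∑-zero (x ∷ xs) = ∑-zero xs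

∑-distrib-+ : ∀ (xs : List A) (f g : A → ℕ) → ∑ xs (λ a → f a + g a) ≡ ∑ xs f + ∑ xs g
∑-distrib-+ []       f g = refl
∑-distrib-+ (x ∷ xs) f g rewrite ∑-distrib-+ xs f g = shuffle (f x) (g x) (∑ xs f) (∑ xs g)
  where
  shuffle : ∀ a b c d → (a + b) + (c + d) ≡ (a + c) + (b + d)
  shuffle = solve-∀

*-distribˡ-∑ : ∀ k (xs : List A) (f : A → ℕ) → k * ∑ xs f ≡ ∑ xs (λ a → k * f a)
*-distribˡ-∑ k []       f = *-zeroʳ k
*-distribˡ-∑ k (x ∷ xs) f = trans (*-distribˡ-+ k (f x) _) (cong (k * f x +_) (*-distribˡ-∑ k xs f))

*-distribʳ-∑ : ∀ k (xs : List A) (f : A → ℕ) → ∑ xs f * k ≡ ∑ xs (λ a → f a * k)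
*-distribʳ-∑ k xs f =
  trans (*-comm (∑ xs f) k) (trans (*-distribˡ-∑ k xs f) (∑-cong xs (λ a → *-comm k (f a))))

∑-comm : ∀ (xs : List A) (ys : List B) (f : A → B → ℕ) →
         ∑ xs (λ a → ∑ ys (f a)) ≡ ∑ ys (λ b → ∑ xs (λ a → f a b))
∑-comm []       ys f = sym (∑-zero ys)
∑-comm (x ∷ xs) ys f =
  trans (cong (∑ ys (f x) +_) (∑-comm xs ys f)) (sym (∑-distrib-+ ys (f x) _))

∑-map : ∀ (g : A → B) (xs : List A) (f : B → ℕ) → ∑ (map g xs) f ≡ ∑ xs (f ∘ g)
∑-map g xs f = cong sum (sym (map-∘ xs))

∑-concatMap : ∀ (g : A → List B) (xs : List A) (f : B → ℕ) →
              ∑ (concatMap g xs) f ≡ ∑ xs (λ a → ∑ (g a) f)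
∑-concatMap g []       f = refl
∑-concatMap g (x ∷ xs) f =
  trans (cong sum (map-++ f (g x) (concatMap g xs)))
        (trans (sum-++ (map f (g x)) _) (cong (∑ (g x) f +_) (∑-concatMap g xs f)))

countᵇ-∷ : ∀ (p : A → Bool) x xs → countᵇ p (x ∷ xs) ≡ 𝟙 (p x) + countᵇ p xs
countᵇ-∷ p x xs with p x
... | true  = refl
... | false = refl

countᵇ≡∑ : ∀ (p : A → Bool) xs → countᵇ p xs ≡ ∑ xs (𝟙 ∘ p)
countᵇ≡∑ p []       = refl
countᵇ≡∑ p (x ∷ xs) = trans (countᵇ-∷ p x xs) (cong (𝟙 (p x) +_) (countᵇ≡∑ p xs))

countᵇ-cong : ∀ {p q : A → Bool} xs → (∀ a → p a ≡ q a) → countᵇ p xs ≡ countᵇ q xs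
countᵇ-cong {p = p} {q} xs p≗q = begin
  countᵇ p xs     ≡⟨ countᵇ≡∑ p xs ⟩
  ∑ xs (𝟙 ∘ p)    ≡⟨ ∑-cong xs (cong 𝟙 ∘ p≗q) ⟩
  ∑ xs (𝟙 ∘ q)    ≡⟨ countᵇ≡∑ q xs ⟨
  countᵇ q xs     ∎
  where open ≡-Reasoning

countᵇ-mono : ∀ {p q : A → Bool} xs → (∀ {a} → a ∈ xs → T (p a) → T (q a)) → countᵇ p xs ≤ countᵇ q xs
countᵇ-mono {p = p} {q} xs p⇒q =
  subst₂ _≤_ (sym (countᵇ≡∑ p xs)) (sym (countᵇ≡∑ q xs)) (∑-mono xs (λ a∈ → 𝟙-mono (p⇒q a∈)))
  where
  𝟙-mono : ∀ {b c} → (T b → T c) → 𝟙 b ≤ 𝟙 c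
  𝟙-mono {false}         _   = z≤n
  𝟙-mono {true}  {true}  _   = ≤-refl
  𝟙-mono {true}  {false} b⇒c = ⊥-elim (b⇒c _)

countᵇ-split : ∀ (b p : A → Bool) xs →
               countᵇ p xs ≡ countᵇ (λ a → p a ∧ not (b a)) xs + countᵇ (λ a → p a ∧ b a) xs
countᵇ-split b p xs = begin
  countᵇ p xs                                         ≡⟨ countᵇ≡∑ p xs ⟩
  ∑ xs (𝟙 ∘ p)                                        ≡⟨ ∑-cong xs (λ a → 𝟙-split (p a) (b a)) ⟩
  ∑ xs (λ a → 𝟙 (p a ∧ not (b a)) + 𝟙 (p a ∧ b a))   ≡⟨ ∑-distrib-+ xs _ _ ⟩
  ∑ xs (λ a → 𝟙 (p a ∧ not (b a))) + ∑ xs (λ a → 𝟙 (p a ∧ b a))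
    ≡⟨ cong₂ _+_ (countᵇ≡∑ _ xs) (countᵇ≡∑ _ xs) ⟨
  countᵇ (λ a → p a ∧ not (b a)) xs + countᵇ (λ a → p a ∧ b a) xs ∎
  where
  open ≡-Reasoning
  𝟙-split : ∀ d c → 𝟙 d ≡ 𝟙 (d ∧ not c) + 𝟙 (d ∧ c)
  𝟙-split false c     = refl
  𝟙-split true  true  = refl
  𝟙-split true  false = refl

countᵇ-∨ : ∀ (p q : A → Bool) xs → countᵇ (λ a → p a ∨ q a) xs ≤ countᵇ p xs + countᵇ q xs
countᵇ-∨ p q xs = begin
  countᵇ (λ a → p a ∨ q a) xs        ≡⟨ countᵇ≡∑ _ xs ⟩
  ∑ xs (λ a → 𝟙 (p a ∨ q a))         ≤⟨ ∑-mono xs (λ {a} _ → 𝟙-∨ (p a) (q a)) ⟩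
  ∑ xs (λ a → 𝟙 (p a) + 𝟙 (q a))     ≡⟨ ∑-distrib-+ xs _ _ ⟩
  ∑ xs (𝟙 ∘ p) + ∑ xs (𝟙 ∘ q)        ≡⟨ cong₂ _+_ (countᵇ≡∑ p xs) (countᵇ≡∑ q xs) ⟨
  countᵇ p xs + countᵇ q xs          ∎
  where
  open ≤-Reasoning
  𝟙-∨ : ∀ b c → 𝟙 (b ∨ c) ≤ 𝟙 b + 𝟙 c
  𝟙-∨ true  c = s≤s z≤n
  𝟙-∨ false c = ≤-refl

𝟙-∧ : ∀ b c → 𝟙 (b ∧ c) ≡ 𝟙 b * 𝟙 c
𝟙-∧ true  c = sym (+-identityʳ (𝟙 c))
𝟙-∧ false c = refl

countᵇ-∧-const : ∀ (p : A → Bool) β xs → countᵇ (λ a → p a ∧ β) xs ≡ countᵇ p xs * 𝟙 β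
countᵇ-∧-const p β xs = begin
  countᵇ (λ a → p a ∧ β) xs        ≡⟨ countᵇ≡∑ _ xs ⟩
  ∑ xs (λ a → 𝟙 (p a ∧ β))         ≡⟨ ∑-cong xs (λ a → 𝟙-∧ (p a) β) ⟩
  ∑ xs (λ a → 𝟙 (p a) * 𝟙 β)       ≡⟨ *-distribʳ-∑ (𝟙 β) xs (𝟙 ∘ p) ⟨
  ∑ xs (𝟙 ∘ p) * 𝟙 β               ≡⟨ cong (_* 𝟙 β) (countᵇ≡∑ p xs) ⟨
  countᵇ p xs * 𝟙 β                ∎
  where open ≡-Reasoning

∑-countᵇ-comm : ∀ (xs : List A) (ys : List B) (p : A → Bool) (q : A → B → Bool) →
                ∑ ys (λ b → countᵇ (λ a → p a ∧ q a b) xs) ≡ ∑ xs (λ a → 𝟙 (p a) * countᵇ (q a) ys)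
∑-countᵇ-comm xs ys p q = begin
  ∑ ys (λ b → countᵇ (λ a → p a ∧ q a b) xs)      ≡⟨ ∑-cong ys (λ b → countᵇ≡∑ _ xs) ⟩
  ∑ ys (λ b → ∑ xs (λ a → 𝟙 (p a ∧ q a b)))       ≡⟨ ∑-comm xs ys _ ⟨
  ∑ xs (λ a → ∑ ys (λ b → 𝟙 (p a ∧ q a b)))
    ≡⟨ ∑-cong xs (λ a → ∑-cong ys (λ b → 𝟙-∧ (p a) (q a b))) ⟩
  ∑ xs (λ a → ∑ ys (λ b → 𝟙 (p a) * 𝟙 (q a b)))
    ≡⟨ ∑-cong xs (λ a → *-distribˡ-∑ (𝟙 (p a)) ys _) ⟨
  ∑ xs (λ a → 𝟙 (p a) * ∑ ys (𝟙 ∘ q a))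
    ≡⟨ ∑-cong xs (λ a → cong (𝟙 (p a) *_) (countᵇ≡∑ (q a) ys)) ⟨
  ∑ xs (λ a → 𝟙 (p a) * countᵇ (q a) ys)         ∎
  where open ≡-Reasoning

countᵇ-map : ∀ (p : B → Bool) (f : A → B) xs → countᵇ p (map f xs) ≡ countᵇ (p ∘ f) xs
countᵇ-map p f xs = trans (countᵇ≡∑ p (map f xs)) (trans (∑-map f xs (𝟙 ∘ p)) (sym (countᵇ≡∑ (p ∘ f) xs)))

countᵇ-filterᵇ : ∀ (p q : A → Bool) xs → countᵇ p (filterᵇ q xs) ≡ countᵇ (λ a → q a ∧ p a) xs
countᵇ-filterᵇ p q []       = refl
countᵇ-filterᵇ p q (x ∷ xs) rewrite countᵇ-∷ (λ a → q a ∧ p a) x xs with q x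
... | true  = trans (countᵇ-∷ p x _) (cong (𝟙 (p x) +_) (countᵇ-filterᵇ p q xs))
... | false = countᵇ-filterᵇ p q xs

countᵇ-true : ∀ (xs : List A) → countᵇ (λ _ → true) xs ≡ length xs
countᵇ-true []       = refl
countᵇ-true (x ∷ xs) = cong suc (countᵇ-true xs)

countᵇ-∈ : ∀ (p : A → Bool) {a} xs → a ∈ xs → T (p a) → 1 ≤ countᵇ p xs
countᵇ-∈ p (x ∷ xs) (here refl) pa rewrite countᵇ-∷ p x xs with p x
... | true = s≤s z≤n
countᵇ-∈ p (x ∷ xs) (there a∈) pa rewrite countᵇ-∷ p x xs =
  ≤-trans (countᵇ-∈ p xs a∈ pa) (m≤n+m _ (𝟙 (p x)))

countᵇ-witness : ∀ (p : A → Bool) xs → 1 ≤ countᵇ p xs → ∃ λ a → a ∈ xs × T (p a)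
countᵇ-witness p (x ∷ xs) 1≤ with p x in px
... | true  = x , here refl , subst T (sym px) _
... | false = let a , a∈ , pa = countᵇ-witness p xs 1≤ in a , there a∈ , pa

countᵇ-none : ∀ (p : A → Bool) xs → (∀ {a} → a ∈ xs → ¬ T (p a)) → countᵇ p xs ≡ 0
countᵇ-none p []       _  = refl
countᵇ-none p (x ∷ xs) ¬p with p x in px
... | true  = ⊥-elim (¬p (here refl) (subst T (sym px) _))
... | false = countᵇ-none p xs (¬p ∘ there)

countᵇ-unique-≤1 : ∀ (p : A → Bool) {xs} → Unique xs → (∀ {a b} → T (p a) → T (p b) → a ≡ b) →
                   countᵇ p xs ≤ 1
countᵇ-unique-≤1 p {[]}     []         _ = z≤n
countᵇ-unique-≤1 p {x ∷ xs} (x∉ ∷ !xs) p-unique with p x in px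
... | false = countᵇ-unique-≤1 p !xs p-unique
... | true  = ≤-reflexive (cong suc (countᵇ-none p xs only-x))
  where
  only-x : ∀ {a} → a ∈ xs → ¬ T (p a)
  only-x a∈ pa = All.lookup x∉ a∈ (p-unique (subst T (sym px) _) pa)

≡ᵇ-uniqueˡ : ∀ {a b x} → T (a ≡ᵇ x) → T (b ≡ᵇ x) → a ≡ b
≡ᵇ-uniqueˡ {a} {b} {x} a≡x b≡x = trans (≡ᵇ⇒≡ a x a≡x) (sym (≡ᵇ⇒≡ b x b≡x))

≡ᵇ-uniqueʳ : ∀ {x a b} → T (x ≡ᵇ a) → T (x ≡ᵇ b) → a ≡ b
≡ᵇ-uniqueʳ {x} {a} {b} x≡a x≡b = trans (sym (≡ᵇ⇒≡ x a x≡a)) (≡ᵇ⇒≡ x b x≡b)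

countᵇ-hits-≤ : ∀ {ys} → Unique ys → ∀ zs → countᵇ (λ a → any (a ≡ᵇ_) zs) ys ≤ length zs
countᵇ-hits-≤ {ys} !ys []       = ≤-reflexive (countᵇ-none _ ys (λ _ ()))
countᵇ-hits-≤ {ys} !ys (z ∷ zs) =
  ≤-trans (countᵇ-∨ (_≡ᵇ z) (λ a → any (a ≡ᵇ_) zs) ys)
          (+-mono-≤ (countᵇ-unique-≤1 (_≡ᵇ z) !ys ≡ᵇ-uniqueˡ)
                    (countᵇ-hits-≤ !ys zs))

countᵇ-misses-≥ : ∀ {ys} → Unique ys → ∀ zs → length ys ∸ length zs ≤ countᵇ (λ a → not (any (a ≡ᵇ_) zs)) ys
countᵇ-misses-≥ {ys} !ys zs = begin
  length ys ∸ length zs        ≤⟨ ∸-monoʳ-≤ (length ys) (countᵇ-hits-≤ !ys zs) ⟩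
  length ys ∸ countᵇ hit ys    ≡⟨ cong (_∸ countᵇ hit ys) (trans (sym (countᵇ-true ys)) (countᵇ-split hit _ ys)) ⟩
  (countᵇ (not ∘ hit) ys + countᵇ hit ys) ∸ countᵇ hit ys   ≡⟨ m+n∸n≡m _ (countᵇ hit ys) ⟩
  countᵇ (not ∘ hit) ys        ∎
  where
  open ≤-Reasoning
  hit : ℕ → Bool
  hit = λ a → any (a ≡ᵇ_) zs

any-∈ : ∀ (p : A → Bool) {x xs} → x ∈ xs → T (p x) → T (any p xs)
any-∈ p (here refl) px = Equivalence.from T-∨ (inj₁ px)
any-∈ p (there x∈)  px = Equivalence.from T-∨ (inj₂ (any-∈ p x∈ px))

allᵇ⁺ : ∀ (p : A → Bool) xs → (∀ {a} → a ∈ xs → T (p a)) → T (allᵇ p xs)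
allᵇ⁺ p []       _  = _
allᵇ⁺ p (x ∷ xs) ps = Equivalence.from T-∧ (ps (here refl) , allᵇ⁺ p xs (ps ∘ there))

allᵇ⁻ : ∀ (p : A → Bool) xs → T (allᵇ p xs) → ∀ {a} → a ∈ xs → T (p a)
allᵇ⁻ p (x ∷ xs) all-p (here refl) = proj₁ (Equivalence.to T-∧ all-p)
allᵇ⁻ p (x ∷ xs) all-p (there a∈)  = allᵇ⁻ p xs (proj₂ (Equivalence.to (T-∧ {p x}) all-p)) a∈

allᵇ-cong : ∀ {p q : A → Bool} xs → (∀ {a} → a ∈ xs → p a ≡ q a) → allᵇ p xs ≡ allᵇ q xs
allᵇ-cong []       _   = refl
allᵇ-cong (x ∷ xs) p≗q = cong₂ _∧_ (p≗q (here refl)) (allᵇ-cong xs (p≗q ∘ there))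

Colouring : ℕ → Set
Colouring n = Fin n → ℕ

recolour : Colouring n → Fin n → ℕ → Colouring n
recolour c v a = updateAt c v (const a)

recolour-id : ∀ (c : Colouring n) {v a} → c v ≡ a → ∀ u → recolour c v a u ≡ c u
recolour-id c {v} cv≡a u with u ≟ v
... | yes refl = trans (updateAt-updates v c) (sym cv≡a)
... | no  u≢v  = updateAt-minimal u v c u≢v

recolour-cong : ∀ {c c′ : Colouring n} {v a} → (∀ u → u ≢ v → c u ≡ c′ u) →
                ∀ u → recolour c v a u ≡ recolour c′ v a u
recolour-cong {c = c} {c′} {v} c≈c′ u with u ≟ v
... | yes refl = trans (updateAt-updates v c) (sym (updateAt-updates v c′))
... | no  u≢v  = trans (updateAt-minimal u v c u≢v) (trans (c≈c′ u u≢v) (sym (updateAt-minimal u v c′ u≢v)))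

-- Proper colourings and available colours

module _ (H : Graph n) where

  neighbours : Fin n → List (Fin n)
  neighbours v = filterᵇ (adj H v) (allFin n)

  available : Colouring n → Fin n → ℕ → Bool
  available c v a = not (any (a ≡ᵇ_) (map c (neighbours v)))

  available-count : ∀ c v {ys} → Unique ys → length ys ∸ deg H v ≤ countᵇ (available c v) ys
  available-count c v {ys} !ys =
    subst (λ d → length ys ∸ d ≤ countᵇ (available c v) ys) (length-map c (neighbours v))
          (countᵇ-misses-≥ !ys (map c (neighbours v)))

  available⇒≢ : ∀ {c v a u} → T (available c v a) → T (adj H v u) → c u ≢ a
  available⇒≢ {c} {v} {a} {u} a-free vu refl = not-b⇒¬b a-free (any-∈ (a ≡ᵇ_) cu∈ (≡⇒≡ᵇ a a refl))
    where
    cu∈ : c u ∈ map c (neighbours v)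
    cu∈ = ∈-map⁺ c (∈-filter⁺ (T? ∘ adj H v) (∈-allFin u) vu)
    not-b⇒¬b : ∀ {b} → T (not b) → ¬ T b
    not-b⇒¬b {true} () _

  compatible : Colouring n → Fin n → Fin n → Bool
  compatible c u w = not (adj H u w) ∨ not (c u ≡ᵇ c w)

  compatible⁺ : ∀ {c u w} → (T (adj H u w) → c u ≢ c w) → T (compatible c u w)
  compatible⁺ {c} {u} {w} uw⇒≢ with adj H u w | c u ≡ᵇ c w in eq
  ... | false | _     = _
  ... | true  | false = _
  ... | true  | true  = uw⇒≢ _ (≡ᵇ⇒≡ (c u) (c w) (subst T (sym eq) _))

  isProper⁺ : ∀ c → (∀ u w → T (compatible c u w)) → T (isProper H c)
  isProper⁺ c ok = allᵇ⁺ _ (allFin n) (λ {u} _ → allᵇ⁺ _ (allFin n) (λ {w} _ → ok u w))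

  isProper⁻ : ∀ c → T (isProper H c) → ∀ u w → T (compatible c u w)
  isProper⁻ c proper u w = allᵇ⁻ _ (allFin n) (allᵇ⁻ _ (allFin n) proper (∈-allFin u)) (∈-allFin w)

  isProper-cong : ∀ {c c′} → (∀ u → c u ≡ c′ u) → isProper H c ≡ isProper H c′
  isProper-cong c≗c′ = allᵇ-cong (allFin n) (λ {u} _ → allᵇ-cong (allFin n) (λ {w} _ →
    cong₂ (λ a b → not (adj H u w) ∨ not (a ≡ᵇ b)) (c≗c′ u) (c≗c′ w)))

  isProper⁺-at : ∀ c v → (∀ u w → u ≢ v → w ≢ v → T (compatible c u w)) →
                (∀ u → T (adj H v u) → c u ≢ c v) → T (isProper H c)
  isProper⁺-at c v away at-v = isProper⁺ c check
    where
    check : ∀ u w → T (compatible c u w)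
    check u w with u ≟ v | w ≟ v
    ... | yes refl | yes refl = compatible⁺ {c} (λ uu → ⊥-elim (subst T (adj-irrefl H u) uu))
    ... | yes refl | no  _    = compatible⁺ {c} (λ uw e → at-v w uw (sym e))
    ... | no  _    | yes refl = compatible⁺ {c} (λ uw → at-v u (subst T (adj-sym H u w) uw))
    ... | no  u≢v  | no  w≢v  = away u w u≢v w≢v

  adj⇒≢ : ∀ {v u} → T (adj H v u) → u ≢ v
  adj⇒≢ {v} vv refl = subst T (adj-irrefl H v) vv

  recolour-proper : ∀ {c v a} → T (isProper H c) → T (available c v a) → T (isProper H (recolour c v a))
  recolour-proper {c} {v} {a} proper a-free = isProper⁺-at (recolour c v a) v away at-v
    where
    away : ∀ u w → u ≢ v → w ≢ v → T (compatible (recolour c v a) u w)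
    away u w u≢v w≢v =
      subst T (cong₂ (λ a b → not (adj H u w) ∨ not (a ≡ᵇ b))
                     (sym (updateAt-minimal u v c u≢v)) (sym (updateAt-minimal w v c w≢v)))
              (isProper⁻ c proper u w)
    at-v : ∀ u → T (adj H v u) → recolour c v a u ≢ recolour c v a v
    at-v u vu = subst₂ _≢_ (sym (updateAt-minimal u v c (adj⇒≢ vu))) (sym (updateAt-updates v c))
                      (available⇒≢ a-free vu)

-- A greedy proper colouring

restrict : Graph (suc n) → Graph n
restrict H = record
  { adj        = λ i j → adj H (suc i) (suc j)
  ; adj-sym    = λ i j → adj-sym H (suc i) (suc j)
  ; adj-irrefl = λ i → adj-irrefl H (suc i)
  }

deg-restrict : ∀ (H : Graph (suc n)) i → deg (restrict H) i ≤ deg H (suc i)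
deg-restrict {n} H i = begin
  countᵇ (adj H (suc i) ∘ suc) (allFin n)    ≡⟨ countᵇ-map (adj H (suc i)) suc (allFin n) ⟨
  countᵇ (adj H (suc i)) (map suc (allFin n)) ≡⟨ cong (countᵇ (adj H (suc i))) (map-tabulate id suc) ⟩
  countᵇ (adj H (suc i)) (tabulate suc)       ≤⟨ m≤n+m _ _ ⟩
  𝟙 (adj H (suc i) zero) + countᵇ (adj H (suc i)) (tabulate suc) ≡⟨ countᵇ-∷ (adj H (suc i)) zero _ ⟨
  deg H (suc i)                               ∎
  where open ≤-Reasoning

consF-∈-choices : ∀ {L : ListAssignment (suc n)} {a g} → a ∈ L zero → g ∈ choices n (L ∘ suc) →
                  consF a g ∈ choices (suc n) L
consF-∈-choices {n} {L} {a} a∈ g∈ =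
  ∈-concatMap⁺ (λ b → map (consF b) (choices n (L ∘ suc))) (Any.map (λ { refl → ∈-map⁺ (consF a) g∈ }) a∈)

consF-proper : ∀ (H : Graph (suc n)) {g a b} → T (isProper (restrict H) g) → T (available H (consF b g) zero a) →
               T (isProper H (consF a g))
consF-proper H {g} {a} g-proper a-free = isProper⁺-at H (consF a g) zero away at-zero
  where
  away : ∀ u w → u ≢ zero → w ≢ zero → T (compatible H (consF a g) u w)
  away zero    _       0≢0 _   = ⊥-elim (0≢0 refl)
  away (suc _) zero    _   0≢0 = ⊥-elim (0≢0 refl)
  away (suc i) (suc j) _   _   = isProper⁻ (restrict H) g g-proper i j
  at-zero : ∀ u → T (adj H zero u) → consF a g u ≢ a
  at-zero zero    loop = ⊥-elim (adj⇒≢ H loop refl)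
  at-zero (suc j) edge = available⇒≢ H a-free edge

proper-colouring-exists : ∀ n (H : Graph n) (L : ListAssignment n) → (∀ v → Unique (L v)) →
                          (∀ v → deg H v < length (L v)) → ∃ λ c → c ∈ choices n L × T (isProper H c)
proper-colouring-exists zero    H L _  _    = (λ ()) , here refl , _
proper-colouring-exists (suc n) H L !L deg< =
  let g , g∈ , g-proper = proper-colouring-exists n (restrict H) (L ∘ suc) (!L ∘ suc)
                            (λ i → ≤-<-trans (deg-restrict H i) (deg< (suc i)))
      a , a∈ , a-free   = countᵇ-witness (available H (consF 0 g) zero) (L zero)
                            (≤-trans (m<n⇒0<n∸m (deg< zero)) (available-count H (consF 0 g) zero (!L zero)))
  in consF a g , consF-∈-choices {L = L} a∈ g∈ , consF-proper H g-proper a-free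

properColourings-nonempty : ∀ (H : Graph n) (L : ListAssignment n) → (∀ v → Unique (L v)) →
                            (∀ v → deg H v < length (L v)) → 1 ≤ length (properColourings H L)
properColourings-nonempty {n} H L !L deg< =
  let c , c∈ , proper = proper-colouring-exists n H L !L deg<
  in subst (1 ≤_) (countᵇ-true (properColourings H L))
           (countᵇ-∈ (λ _ → true) (properColourings H L) (∈-filter⁺ (T? ∘ isProper H) c∈ proper) _)

-- Counting L-colourings by the colour of one vertex

countᵇ-choices : ∀ (p : Colouring (suc n) → Bool) (L : ListAssignment (suc n)) →
                 countᵇ p (choices (suc n) L) ≡ ∑ (L zero) (λ b → countᵇ (p ∘ consF b) (choices n (L ∘ suc)))
countᵇ-choices {n} p L = begin
  countᵇ p (choices (suc n) L)                                      ≡⟨ countᵇ≡∑ p (choices (suc n) L) ⟩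
  ∑ (concatMap (λ b → map (consF b) rest) (L zero)) (𝟙 ∘ p)          ≡⟨ ∑-concatMap _ (L zero) (𝟙 ∘ p) ⟩
  ∑ (L zero) (λ b → ∑ (map (consF b) rest) (𝟙 ∘ p))
    ≡⟨ ∑-cong (L zero) (λ b → countᵇ≡∑ p (map (consF b) rest)) ⟨
  ∑ (L zero) (λ b → countᵇ p (map (consF b) rest))
    ≡⟨ ∑-cong (L zero) (λ b → countᵇ-map p (consF b) rest) ⟩
  ∑ (L zero) (λ b → countᵇ (p ∘ consF b) rest)                      ∎
  where
  open ≡-Reasoning
  rest : List (Colouring n)
  rest = choices n (L ∘ suc)

InsensitiveAt : Fin n → (Colouring n → Bool) → Set
InsensitiveAt v R = ∀ {c c′} → (∀ u → u ≢ v → c u ≡ c′ u) → R c ≡ R c′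

fibre-count : ∀ n (L : ListAssignment n) v (R : Colouring n → Bool) → InsensitiveAt v R →
              ∃ λ M → ∀ y → countᵇ (λ c → R c ∧ (c v ≡ᵇ y)) (choices n L) ≡ M * countᵇ (_≡ᵇ y) (L v)
fibre-count (suc n) L zero R R-insensitive = M , fibre
  where
  rest : List (Colouring n)
  rest = choices n (L ∘ suc)
  M : ℕ
  M = countᵇ (R ∘ consF 0) rest
  fibre : ∀ y → countᵇ (λ c → R c ∧ (c zero ≡ᵇ y)) (choices (suc n) L) ≡ M * countᵇ (_≡ᵇ y) (L zero)
  fibre y = begin
    countᵇ (λ c → R c ∧ (c zero ≡ᵇ y)) (choices (suc n) L)          ≡⟨ countᵇ-choices _ L ⟩
    ∑ (L zero) (λ b → countᵇ (λ g → R (consF b g) ∧ (b ≡ᵇ y)) rest)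
      ≡⟨ ∑-cong (L zero) (λ b → countᵇ-cong rest (λ g → cong (_∧ (b ≡ᵇ y)) (R-insensitive off-zero))) ⟩
    ∑ (L zero) (λ b → countᵇ (λ g → R (consF 0 g) ∧ (b ≡ᵇ y)) rest)
      ≡⟨ ∑-cong (L zero) (λ b → countᵇ-∧-const _ (b ≡ᵇ y) rest) ⟩
    ∑ (L zero) (λ b → M * 𝟙 (b ≡ᵇ y))                             ≡⟨ *-distribˡ-∑ M (L zero) _ ⟨
    M * ∑ (L zero) (λ b → 𝟙 (b ≡ᵇ y))                             ≡⟨ cong (M *_) (countᵇ≡∑ (_≡ᵇ y) (L zero)) ⟨
    M * countᵇ (_≡ᵇ y) (L zero)                                    ∎
    where
    open ≡-Reasoning
    off-zero : ∀ {b g} u → u ≢ zero → consF b g u ≡ consF 0 g u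
    off-zero zero    0≢0 = ⊥-elim (0≢0 refl)
    off-zero (suc i) _   = refl
fibre-count (suc n) L (suc w) R R-insensitive = ∑ (L zero) (proj₁ ∘ fibres) , fibre
  where
  rest : List (Colouring n)
  rest = choices n (L ∘ suc)
  fibres : ∀ b → ∃ λ M → ∀ y →
           countᵇ (λ g → R (consF b g) ∧ (g w ≡ᵇ y)) rest ≡ M * countᵇ (_≡ᵇ y) (L (suc w))
  fibres b = fibre-count n (L ∘ suc) w (R ∘ consF b) (λ g≈g′ → R-insensitive (lift g≈g′))
    where
    lift : ∀ {g g′ : Colouring n} → (∀ u → u ≢ w → g u ≡ g′ u) →
           ∀ u → u ≢ suc w → consF b g u ≡ consF b g′ u
    lift g≈g′ zero    _     = refl
    lift g≈g′ (suc u) u≢sw = g≈g′ u (λ u≡w → u≢sw (cong suc u≡w))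
  fibre : ∀ y → countᵇ (λ c → R c ∧ (c (suc w) ≡ᵇ y)) (choices (suc n) L)
                ≡ ∑ (L zero) (proj₁ ∘ fibres) * countᵇ (_≡ᵇ y) (L (suc w))
  fibre y = begin
    countᵇ (λ c → R c ∧ (c (suc w) ≡ᵇ y)) (choices (suc n) L)             ≡⟨ countᵇ-choices _ L ⟩
    ∑ (L zero) (λ b → countᵇ (λ g → R (consF b g) ∧ (g w ≡ᵇ y)) rest)
      ≡⟨ ∑-cong (L zero) (λ b → proj₂ (fibres b) y) ⟩
    ∑ (L zero) (λ b → proj₁ (fibres b) * countᵇ (_≡ᵇ y) (L (suc w)))     ≡⟨ *-distribʳ-∑ _ (L zero) _ ⟨
    ∑ (L zero) (proj₁ ∘ fibres) * countᵇ (_≡ᵇ y) (L (suc w))             ∎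
    where open ≡-Reasoning

Extensional : (Colouring n → Bool) → Set
Extensional Q = ∀ {c c′} → (∀ u → c u ≡ c′ u) → Q c ≡ Q c′

recolour-count : ∀ n (L : ListAssignment n) (Q : Colouring n → Bool) → Extensional Q →
                 ∀ v {a x} → countᵇ (_≡ᵇ x) (L v) ≤ countᵇ (_≡ᵇ a) (L v) →
                 countᵇ (λ c → Q (recolour c v a) ∧ (c v ≡ᵇ x)) (choices n L)
                   ≤ countᵇ (λ c → Q c ∧ (c v ≡ᵇ a)) (choices n L)
recolour-count n L Q Q-ext v {a} {x} x≤a = begin
  countᵇ (λ c → Q (recolour c v a) ∧ (c v ≡ᵇ x)) (choices n L)   ≡⟨ proj₂ fibres x ⟩
  proj₁ fibres * countᵇ (_≡ᵇ x) (L v)                           ≤⟨ *-monoʳ-≤ (proj₁ fibres) x≤a ⟩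
  proj₁ fibres * countᵇ (_≡ᵇ a) (L v)                           ≡⟨ proj₂ fibres a ⟨
  countᵇ (λ c → Q (recolour c v a) ∧ (c v ≡ᵇ a)) (choices n L)   ≡⟨ countᵇ-cong (choices n L) already-a ⟨
  countᵇ (λ c → Q c ∧ (c v ≡ᵇ a)) (choices n L)                  ∎
  where
  open ≤-Reasoning
  fibres : ∃ λ M → ∀ y →
           countᵇ (λ c → Q (recolour c v a) ∧ (c v ≡ᵇ y)) (choices n L) ≡ M * countᵇ (_≡ᵇ y) (L v)
  fibres = fibre-count n L v (λ c → Q (recolour c v a))
             (λ c≈c′ → Q-ext (recolour-cong c≈c′))
  already-a : ∀ c → Q c ∧ (c v ≡ᵇ a) ≡ Q (recolour c v a) ∧ (c v ≡ᵇ a)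
  already-a c with c v ≡ᵇ a in eq
  ... | true  = cong (_∧ true) (sym (Q-ext (recolour-id c (≡ᵇ⇒≡ (c v) a (subst T (sym eq) _)))))
  ... | false = trans (∧-zeroʳ (Q c)) (sym (∧-zeroʳ _))

-- Double count the pairs (c, a) with c v = x and a available for c at v: recolouring sends such a pair
-- to a colouring with colour a at v, injectively for fixed a, and a colouring has one colour at v.
recolouring-bound : ∀ (H : Graph n) (L : ListAssignment n) (Q : Colouring n → Bool) → Extensional Q →
                    ∀ {v} → (∀ {c a} → T (Q c) → T (available H c v a) → T (Q (recolour c v a))) →
                    Unique (L v) → ∀ x →
                    (length (L v) ∸ deg H v) * countᵇ (λ c → Q c ∧ (c v ≡ᵇ x)) (choices n L)
                      ≤ countᵇ Q (choices n L)
recolouring-bound {n} H L Q Q-ext {v} Q-recolour !Lv x = begin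
  k * countᵇ p cs                                              ≡⟨ cong (k *_) (countᵇ≡∑ p cs) ⟩
  k * ∑ cs (𝟙 ∘ p)                                             ≡⟨ *-distribˡ-∑ k cs (𝟙 ∘ p) ⟩
  ∑ cs (λ c → k * 𝟙 (p c))
    ≤⟨ ∑-mono cs (λ {c} _ → scale-𝟙 (p c) (available-count H c v !Lv)) ⟩
  ∑ cs (λ c → 𝟙 (p c) * countᵇ (available H c v) (L v))
    ≡⟨ ∑-countᵇ-comm cs (L v) p (λ c → available H c v) ⟨
  ∑ (L v) (λ a → countᵇ (λ c → p c ∧ available H c v a) cs)
    ≤⟨ ∑-mono (L v) (λ _ → countᵇ-mono cs (λ _ → recolour-hit)) ⟩
  ∑ (L v) (λ a → countᵇ (λ c → Q (recolour c v a) ∧ (c v ≡ᵇ x)) cs)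
    ≤⟨ ∑-mono (L v) (λ a∈ → recolour-count n L Q Q-ext v (x-rare a∈)) ⟩
  ∑ (L v) (λ a → countᵇ (λ c → Q c ∧ (c v ≡ᵇ a)) cs)
    ≡⟨ ∑-countᵇ-comm cs (L v) Q (λ c a → c v ≡ᵇ a) ⟩
  ∑ cs (λ c → 𝟙 (Q c) * countᵇ (c v ≡ᵇ_) (L v))
    ≤⟨ ∑-mono cs (λ {c} _ → 𝟙-*-≤1 (Q c) (countᵇ-unique-≤1 (c v ≡ᵇ_) !Lv (≡ᵇ-uniqueʳ {c v}))) ⟩
  ∑ cs (𝟙 ∘ Q)                                                 ≡⟨ countᵇ≡∑ Q cs ⟨
  countᵇ Q cs                                                  ∎
  where
  open ≤-Reasoning
  cs : List (Colouring n)
  cs = choices n L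
  k : ℕ
  k = length (L v) ∸ deg H v
  p : Colouring n → Bool
  p = λ c → Q c ∧ (c v ≡ᵇ x)
  scale-𝟙 : ∀ b {m} → k ≤ m → k * 𝟙 b ≤ 𝟙 b * m
  scale-𝟙 true  {m} k≤m = subst₂ _≤_ (sym (*-identityʳ k)) (sym (+-identityʳ m)) k≤m
  scale-𝟙 false     _   = ≤-reflexive (*-zeroʳ k)
  𝟙-*-≤1 : ∀ b {m} → m ≤ 1 → 𝟙 b * m ≤ 𝟙 b
  𝟙-*-≤1 true  {m} m≤1 = subst (_≤ 1) (sym (+-identityʳ m)) m≤1
  𝟙-*-≤1 false     _   = z≤n
  recolour-hit : ∀ {c a} → T (p c ∧ available H c v a) → T (Q (recolour c v a) ∧ (c v ≡ᵇ x))
  recolour-hit hit-free =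
    let hit , free = Equivalence.to T-∧ hit-free
        q , c≡x    = Equivalence.to T-∧ hit
    in Equivalence.from T-∧ (Q-recolour q free , c≡x)
  x-rare : ∀ {a} → a ∈ L v → countᵇ (_≡ᵇ x) (L v) ≤ countᵇ (_≡ᵇ a) (L v)
  x-rare {a} a∈ = ≤-trans (countᵇ-unique-≤1 (_≡ᵇ x) !Lv ≡ᵇ-uniqueˡ)
                          (countᵇ-∈ (_≡ᵇ a) (L v) a∈ (≡⇒≡ᵇ a a refl))

-- Avoiding a colour

complement-≥ : ∀ j a b → suc j * b ≤ a + b → j * (a + b) ≤ suc j * a
complement-≥ j a b sj*b≤a+b = begin
  j * (a + b)     ≡⟨ *-distribˡ-+ j a b ⟩
  j * a + j * b   ≤⟨ +-monoʳ-≤ (j * a) j*b≤a ⟩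
  j * a + a       ≡⟨ +-comm (j * a) a ⟩
  suc j * a       ∎
  where
  open ≤-Reasoning
  j*b≤a : j * b ≤ a
  j*b≤a = +-cancelʳ-≤ b (j * b) a (subst (_≤ a + b) (+-comm b (j * b)) sj*b≤a+b)

-- pred∏suc ms = ∏ (1 + m) ∸ 1, arranged so that 1 + pred∏suc (m ∷ ms) computes to
-- (1 + m) * (1 + pred∏suc ms); it is the denominator-minus-one of the rational ∏ m / (1 + m).
pred∏suc : List ℕ → ℕ
pred∏suc []       = 0
pred∏suc (m ∷ ms) = pred∏suc ms + m * suc (pred∏suc ms)

avoidsOn : ℕ → List (Fin n) → Colouring n → Bool
avoidsOn x ws c = allᵇ (λ v → not (c v ≡ᵇ x)) ws

module Avoidance (H : Graph n) (L : ListAssignment n) (!L : ∀ v → Unique (L v)) (x : ℕ) where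

  avoiding : List (Fin n) → ℕ
  avoiding ws = countᵇ (avoidsOn x ws) (properColourings H L)

  hitting : Fin n → List (Fin n) → ℕ
  hitting v ws = countᵇ (λ c → avoidsOn x ws c ∧ (c v ≡ᵇ x)) (properColourings H L)

  avoiding-[] : avoiding [] ≡ length (properColourings H L)
  avoiding-[] = countᵇ-true (properColourings H L)

  avoiding-split : ∀ v ws → avoiding ws ≡ avoiding (v ∷ ws) + hitting v ws
  avoiding-split v ws =
    trans (countᵇ-split (λ c → c v ≡ᵇ x) (avoidsOn x ws) (properColourings H L))
          (cong (_+ hitting v ws) (countᵇ-cong (properColourings H L) (λ c → ∧-comm (avoidsOn x ws c) _)))

  hitting-bound : ∀ {v ws} → ¬ v ∈ ws → (length (L v) ∸ deg H v) * hitting v ws ≤ avoiding ws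
  hitting-bound {v} {ws} v∉ =
    subst₂ (λ h a → (length (L v) ∸ deg H v) * h ≤ a)
      (trans (countᵇ-cong cs (λ c → ∧-assoc (isProper H c) _ _)) (sym (countᵇ-filterᵇ _ (isProper H) cs)))
      (sym (countᵇ-filterᵇ _ (isProper H) cs))
      (recolouring-bound H L Q Q-ext Q-recolour (!L v) x)
    where
    cs : List (Colouring n)
    cs = choices n L
    Q : Colouring n → Bool
    Q = λ c → isProper H c ∧ avoidsOn x ws c
    Q-ext : Extensional Q
    Q-ext c≈c′ = cong₂ _∧_ (isProper-cong H c≈c′)
                           (allᵇ-cong ws (λ {u} _ → cong (λ t → not (t ≡ᵇ x)) (c≈c′ u)))
    Q-recolour : ∀ {c a} → T (Q c) → T (available H c v a) → T (Q (recolour c v a))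
    Q-recolour {c} {a} q free =
      let proper , avoids = Equivalence.to T-∧ q
      in Equivalence.from T-∧ (recolour-proper H proper free , subst T (sym v-untouched) avoids)
      where
      v-untouched : avoidsOn x ws (recolour c v a) ≡ avoidsOn x ws c
      v-untouched = allᵇ-cong ws (λ {u} u∈ → cong (λ t → not (t ≡ᵇ x))
                      (updateAt-minimal u v c (λ { refl → v∉ u∈ })))

  avoiding-bound : (j : Fin n → ℕ) → (∀ v → length (L v) ∸ deg H v ≡ suc (j v)) → ∀ ws → Unique ws →
                   product (map j ws) * avoiding [] ≤ avoiding ws * suc (pred∏suc (map j ws))
  avoiding-bound j k≡1+j []       _           = ≤-reflexive (trans (+-identityʳ _) (sym (*-identityʳ _)))
  avoiding-bound j k≡1+j (v ∷ ws) (v∉ ∷ !ws) = begin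
    j v * P * avoiding []            ≡⟨ *-assoc (j v) P (avoiding []) ⟩
    j v * (P * avoiding [])          ≤⟨ *-monoʳ-≤ (j v) (avoiding-bound j k≡1+j ws !ws) ⟩
    j v * (avoiding ws * D)          ≡⟨ *-assoc (j v) (avoiding ws) D ⟨
    j v * avoiding ws * D            ≤⟨ *-monoˡ-≤ D one-step ⟩
    suc (j v) * avoiding (v ∷ ws) * D ≡⟨ reorder (j v) (avoiding (v ∷ ws)) D ⟩
    avoiding (v ∷ ws) * (D + j v * D) ∎
    where
    open ≤-Reasoning
    P : ℕ
    P = product (map j ws)
    D : ℕ
    D = suc (pred∏suc (map j ws))
    reorder : ∀ m a d → suc m * a * d ≡ a * (d + m * d)
    reorder = solve-∀
    one-step : j v * avoiding ws ≤ suc (j v) * avoiding (v ∷ ws)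
    one-step = subst (λ t → j v * t ≤ suc (j v) * avoiding (v ∷ ws)) (sym (avoiding-split v ws))
      (complement-≥ (j v) (avoiding (v ∷ ws)) (hitting v ws)
        (subst₂ (λ k t → k * hitting v ws ≤ t) (k≡1+j v) (avoiding-split v ws) (hitting-bound (All¬⇒¬Any v∉))))

-- From counts to probabilities

frac-toℚᵘ : ∀ p q → toℚᵘ (frac p (suc q)) ≃ᵘ mkℚᵘ (ℤ.+ p) q
frac-toℚᵘ p q = toℚᵘ-fromℚᵘ (mkℚᵘ (ℤ.+ p) q)

one-minus-frac-toℚᵘ : ∀ m → toℚᵘ (1ℚ ℚ.- frac 1 (suc m)) ≃ᵘ mkℚᵘ (ℤ.+ m) m
one-minus-frac-toℚᵘ m = begin-equality
  toℚᵘ (1ℚ ℚ.- frac 1 (suc m))               ≃⟨ toℚᵘ-homo-+ 1ℚ (ℚ.- frac 1 (suc m)) ⟩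
  toℚᵘ 1ℚ ℚᵘ.+ toℚᵘ (ℚ.- frac 1 (suc m))
    ≃⟨ ℚᵘₚ.+-congʳ (toℚᵘ 1ℚ) negated ⟩
  1-1/[1+m]                                    ≃⟨ *≡* cross-multiplied ⟩
  mkℚᵘ (ℤ.+ m) m                               ∎
  where
  open ℚᵘₚ.≤-Reasoning
  negated : toℚᵘ (ℚ.- frac 1 (suc m)) ≃ᵘ ℚᵘ.- mkℚᵘ (ℤ.+ 1) m
  negated = ℚᵘₚ.≃-trans (toℚᵘ-homo‿- (frac 1 (suc m))) (ℚᵘₚ.-‿cong (frac-toℚᵘ 1 m))
  1-1/[1+m] : ℚᵘ.ℚᵘ
  1-1/[1+m] = ℚᵘ.1ℚᵘ ℚᵘ.+ ℚᵘ.- mkℚᵘ (ℤ.+ 1) m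
  cross-multiplied : ℚᵘ.↥ 1-1/[1+m] ℤ.* ℤ.+ suc m ≡ ℤ.+ m ℤ.* ℚᵘ.↧ 1-1/[1+m]
  cross-multiplied rewrite +-identityʳ m = refl

∏1-1/suc : List ℕ → ℚ.ℚ
∏1-1/suc = foldr (λ m r → (1ℚ ℚ.- frac 1 (suc m)) ℚ.* r) 1ℚ

∏1-1/suc-toℚᵘ : ∀ ms → toℚᵘ (∏1-1/suc ms) ≃ᵘ mkℚᵘ (ℤ.+ product ms) (pred∏suc ms)
∏1-1/suc-toℚᵘ []       = ℚᵘₚ.≃-refl
∏1-1/suc-toℚᵘ (m ∷ ms) =
  ℚᵘₚ.≃-trans (toℚᵘ-homo-* (1ℚ ℚ.- frac 1 (suc m)) (∏1-1/suc ms))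
    (ℚᵘₚ.≃-trans (ℚᵘₚ.*-cong (one-minus-frac-toℚᵘ m) (∏1-1/suc-toℚᵘ ms))
      (ℚᵘₚ.≃-reflexive (cong (λ i → mkℚᵘ i (pred∏suc (m ∷ ms))) (sym (ℤₚ.pos-* m (product ms))))))

bound≡∏1-1/suc : ∀ (H : Graph n) (L : ListAssignment n) (j : Fin n → ℕ) →
                 (∀ v → length (L v) ∸ deg H v ≡ suc (j v)) → bound H L ≡ ∏1-1/suc (map j (allFin n))
bound≡∏1-1/suc {n} H L j k≡1+j =
  trans (foldr-cong (λ v r → cong (λ k → (1ℚ ℚ.- frac 1 k) ℚ.* r) (k≡1+j v)) refl (allFin n))
        (sym (foldr-map _ j 1ℚ (allFin n)))

mkℚᵘ-≤-frac : ∀ {P D A N} → P * N ≤ A * suc D → 1 ≤ N → mkℚᵘ (ℤ.+ P) D ≤ᵘ toℚᵘ (frac A N)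
mkℚᵘ-≤-frac {P} {D} {A} {suc N} cross _ =
  ℚᵘₚ.≤-respʳ-≃ (ℚᵘₚ.≃-sym (frac-toℚᵘ A N))
    (*≤* (subst₂ ℤ._≤_ (ℤₚ.pos-* P (suc N)) (ℤₚ.pos-* A (suc D)) (ℤ.+≤+ cross)))

-- The bound holds for every colour x.
lemma2 : ∀ {n} (H : Graph n) (L : ListAssignment n) →
    (∀ v → Unique (L v)) →
    (∀ v → deg H v + 1 Data.Nat.≤ length (L v)) →
    ∀ (x : ℕ) → ∃ (λ v → x ∈ L v) →
    bound H L Data.Rational.≤ probAvoid H L x
lemma2 {n} H L !L deg+1≤ x _ = toℚᵘ-cancel-≤ (begin
  toℚᵘ (bound H L)                     ≡⟨ cong toℚᵘ (bound≡∏1-1/suc H L j k≡1+j) ⟩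
  toℚᵘ (∏1-1/suc js)                   ≃⟨ ∏1-1/suc-toℚᵘ js ⟩
  mkℚᵘ (ℤ.+ product js) (pred∏suc js)  ≤⟨ mkℚᵘ-≤-frac counted (properColourings-nonempty H L !L deg<) ⟩
  toℚᵘ (probAvoid H L x)               ∎)
  where
  open ℚᵘₚ.≤-Reasoning
  open Avoidance H L !L x
  deg< : ∀ v → deg H v < length (L v)
  deg< v = subst (_≤ length (L v)) (+-comm (deg H v) 1) (deg+1≤ v)
  j : Fin n → ℕ
  j v = pred (length (L v) ∸ deg H v)
  k≡1+j : ∀ v → length (L v) ∸ deg H v ≡ suc (j v)
  k≡1+j v = sym (suc-pred _ {{>-nonZero (m<n⇒0<n∸m (deg< v))}})
  js : List ℕ
  js = map j (allFin n)
  counted : product js * length (properColourings H L) ≤ avoiding (allFin n) * suc (pred∏suc js)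
  counted = subst (λ N → product js * N ≤ avoiding (allFin n) * suc (pred∏suc js)) avoiding-[]
                  (avoiding-bound j k≡1+j (allFin n) (allFin⁺ n))
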